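{- For every integer $k\ge 2$, there exist a connected split graph $G=(K\uplus S,E)$ and two D$2$DSs $D_s,D_t$ of $G$, each of size $k$, such that $\mathrm{opt}_{\mathsf{TS}}(G,D_s,D_t)=M^\star_{\mathsf{TS}}(G,D_s,D_t)+2$.
   Context: A split graph $G=(K\uplus S,E)$ has vertex set partitioned into a clique $K$ and an independent set $S$. A D$2$DS of $G$ is a set $D\subseteq V(G)$ such that every vertex is at distance at most $2$ from some vertex of $D$. A $\mathsf{TS}$-sequence between D$2$DSs $D_s,D_t$ is a sequence $D_s=D_0,\dots,D_q=D_t$ of D$2$DSs with $D_i\setminus D_{i+1}=\{x_i\}$, $D_{i+1}\setminus D_i=\{y_i\}$, $x_iy_i\in E(G)$ for each $i$; its length is $q$. $\mathrm{opt}_{\mathsf{TS}}(G,D_s,D_t)$ is the minimum length of a $\mathsf{TS}$-sequence between $D_s$ and $D_t$ ($\infty$ if none). With $D_s=\{s_1,\dots,s_k\}$, $M^\star_{\mathsf{TS}}(G,D_s,D_t)=\min_f\sum_{i=1}^k\mathrm{dist}_G(s_i,f(s_i))$ over bijections $f:D_s\to D_t$. -}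

module Defs where

open import Data.Nat using (ℕ; zero; suc; _+_; _≤_; _<_)
open import Data.Bool using (Bool; true; false; if_then_else_)
open import Data.Fin using (Fin)
open import Data.Fin.Subset using (Subset; _∈_; _∉_; ∣_∣)
open import Data.Vec using (lookup; tabulate; sum)
open import Data.Product using (Σ; ∃; _×_; _,_)
open import Relation.Binary.PropositionalEquality using (_≡_; _≢_)
open import Relation.Nullary using (¬_)

record Graph (n : ℕ) : Set where
  field
    E     : Fin n → Fin n → Bool
    sym   : ∀ u v → E u v ≡ E v u
    irref : ∀ u → E u u ≡ false

open Graph public

Adj : ∀ {n} → Graph n → Fin n → Fin n → Set
Adj G u v = E G u v ≡ true

data Walk {n : ℕ} (G : Graph n) : Fin n → Fin n → ℕ → Set where
  here : ∀ {u} → Walk G u u 0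
  there : ∀ {u w v d} → Adj G u w → Walk G w v d → Walk G u v (suc d)

IsDist : ∀ {n} → Graph n → Fin n → Fin n → ℕ → Set
IsDist G u v d = Walk G u v d × (∀ m → Walk G u v m → d ≤ m)

Connected : ∀ {n} → Graph n → Set
Connected G = ∀ u v → ∃ λ d → Walk G u v d

IsSplit : ∀ {n} → Graph n → Set
IsSplit {n} G = Σ (Subset n) λ K →
  (∀ u v → u ∈ K → v ∈ K → u ≢ v → Adj G u v) ×
  (∀ u v → u ∉ K → v ∉ K → ¬ Adj G u v)

IsD2DS : ∀ {n} → Graph n → Subset n → Set
IsD2DS {n} G D = ∀ v → Σ (Fin n) λ u → u ∈ D × Σ ℕ λ d → d ≤ 2 × Walk G u v d

TSStep : ∀ {n} → Graph n → Subset n → Subset n → Set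
TSStep {n} G D D' = Σ (Fin n) λ x → Σ (Fin n) λ y →
  x ∈ D × x ∉ D' × y ∉ D × y ∈ D' × Adj G x y ×
  (∀ z → z ≢ x → z ≢ y → (z ∈ D → z ∈ D') × (z ∈ D' → z ∈ D))

data TSSeq {n : ℕ} (G : Graph n) : Subset n → Subset n → ℕ → Set where
  done : ∀ {D} → IsD2DS G D → TSSeq G D D 0
  step : ∀ {D D' D'' q} → IsD2DS G D → TSStep G D D' → TSSeq G D' D'' q →
         TSSeq G D D'' (suc q)

IsOptTS : ∀ {n} → Graph n → Subset n → Subset n → ℕ → Set
IsOptTS G Ds Dt q = TSSeq G Ds Dt q × (∀ m → TSSeq G Ds Dt m → q ≤ m)

IsBij : ∀ {n} → Subset n → Subset n → (Fin n → Fin n) → Set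
IsBij {n} Ds Dt f =
  (∀ z → z ∈ Ds → f z ∈ Dt) ×
  (∀ z z' → z ∈ Ds → z' ∈ Ds → f z ≡ f z' → z ≡ z') ×
  (∀ w → w ∈ Dt → Σ (Fin n) λ z → z ∈ Ds × f z ≡ w)

BijCost : ∀ {n} → Graph n → Subset n → (Fin n → Fin n) → ℕ → Set
BijCost {n} G Ds f c = Σ (Fin n → ℕ) λ d →
  (∀ z → z ∈ Ds → IsDist G z (f z) (d z)) ×
  c ≡ sum (tabulate λ z → if lookup Ds z then d z else 0)

IsMstar : ∀ {n} → Graph n → Subset n → Subset n → ℕ → Set
IsMstar {n} G Ds Dt m =
  (Σ (Fin n → Fin n) λ f → IsBij Ds Dt f × BijCost G Ds f m) ×
  (∀ f c → IsBij Ds Dt f → BijCost G Ds f c → m ≤ c)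

-- Take the split graph with clique K = {a, b}, a pendant vertex c on b, and pendant
-- vertices u, w, x₁, …, x_{k-2} on a; let Ds = {a, u, x₁, …} and Dt = {a, w, x₁, …}.
-- Sending u to w through a costs M* = 2.  The graph is bipartite with sides {a, c} and
-- the rest, and every token slide crosses sides, so the parity of the number of tokens
-- on {a, c} flips at each step; Ds and Dt have the same parity, so a TS-sequence has
-- even length.  It cannot have length 2: the only first slide keeping c dominated is
-- a → b, and the resulting set differs from Dt in more than two vertices.
module Submission where

open import Defs hiding (sym)
open import Data.Nat using (ℕ; zero; suc; _+_; _≤_; z≤n; s≤s)
open import Data.Nat.Properties using (≤-trans; m≤m+n; m≤n+m; +-monoʳ-≤; +-mono-≤; +-comm)
open import Data.Nat.GeneralisedArithmetic using (iterate)
open import Data.Bool using (Bool; true; false; not; _∧_; _∨_; _xor_; if_then_else_)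
open import Data.Bool.Properties
  using (xor-comm; xor-assoc; xor-same; xor-identityʳ; ∨-comm; ∧-identityʳ; ∧-zeroʳ; if-eta)
open import Data.Fin using (Fin; zero; suc; _≟_)
open import Data.Fin.Subset using (Subset; ∣_∣; _∈_; _∉_; ⊤)
open import Data.Fin.Subset.Properties using (∈⊤; ∣⊤∣≡n)
open import Data.Vec using (_∷_; []; here; there; lookup; tabulate; sum; _[_]≔_)
open import Data.Vec.Properties
  using ([]=⇒lookup; lookup⇒[]=; lookup∘update; lookup∘update′; lookup∘tabulate)
open import Data.Vec.Relation.Binary.Pointwise.Extensional using (ext; Pointwise-≡⇒≡)
open import Data.Product using (Σ; ∃; ∃₂; _×_; _,_; proj₁)
open import Data.Sum using (_⊎_; inj₁; inj₂)
open import Data.Empty using (⊥; ⊥-elim)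
open import Function using (_∘_; case_of_)
open import Relation.Nullary using (¬_; Dec; yes; no)
open import Relation.Binary.PropositionalEquality
  using (_≡_; _≢_; refl; sym; trans; cong; cong₂; subst; module ≡-Reasoning)

open ≡-Reasoning

module _ {n : ℕ} (G : Graph n) where

  _++ʷ_ : ∀ {u v w d e} → Walk G u v d → Walk G v w e → Walk G u w (d + e)
  here ++ʷ q = q
  there uv p ++ʷ q = there uv (p ++ʷ q)

  reverseʷ : ∀ {u v d} → Walk G u v d → Walk G v u d
  reverseʷ here = here
  reverseʷ {u} (there {w = w} {d = d} uw p) =
    subst (Walk G _ u) (+-comm d 1) (reverseʷ p ++ʷ there (trans (Graph.sym G w u) uw) here)

  hub⇒Connected : (h : Fin n) → (∀ v → ∃ λ d → Walk G h v d) → Connected G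
  hub⇒Connected h reach u v with reach u | reach v
  ... | _ , hu | _ , hv = _ , (reverseʷ hu ++ʷ hv)

  walk-length-pos : ∀ {u v d} → Walk G u v d → u ≢ v → 1 ≤ d
  walk-length-pos here u≢u = ⊥-elim (u≢u refl)
  walk-length-pos (there _ _) _ = s≤s z≤n

∉⇒lookup≡false : ∀ {n} {D : Subset n} {z} → z ∉ D → lookup D z ≡ false
∉⇒lookup≡false {D = D} {z} z∉D with lookup D z in eq
... | true = ⊥-elim (z∉D (lookup⇒[]= z D eq))
... | false = refl

lookup≡false⇒∉ : ∀ {n} {D : Subset n} {z} → lookup D z ≡ false → z ∉ D
lookup≡false⇒∉ eq z∈D = case trans (sym eq) ([]=⇒lookup z∈D) of λ ()

∈⇔⇒lookup≡ : ∀ {n} {D D' : Subset n} {z} →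
             (z ∈ D → z ∈ D') × (z ∈ D' → z ∈ D) → lookup D' z ≡ lookup D z
∈⇔⇒lookup≡ {D = D} {D'} {z} (to , from) with lookup D z in eq
... | true = []=⇒lookup (to (lookup⇒[]= z D eq))
... | false = ∉⇒lookup≡false (lookup≡false⇒∉ eq ∘ from)

∈∉⇒≢ : ∀ {n} {D : Subset n} {x y} → x ∈ D → y ∉ D → x ≢ y
∈∉⇒≢ x∈D y∉D refl = y∉D x∈D

slide : ∀ {n} → Subset n → Fin n → Fin n → Subset n
slide D x y = D [ x ]≔ false [ y ]≔ true

slide-unchanged : ∀ {n} (D : Subset n) {x y z} → z ≢ x → z ≢ y → lookup (slide D x y) z ≡ lookup D z
slide-unchanged D {x} z≢x z≢y =
  trans (lookup∘update′ z≢y (D [ x ]≔ false) true) (lookup∘update′ z≢x D false)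

slide-changed : ∀ {n} (D : Subset n) {x y} z → lookup (slide D x y) z ≢ lookup D z → z ≡ x ⊎ z ≡ y
slide-changed D {x} {y} z changed with z ≟ x | z ≟ y
... | yes z≡x | _ = inj₁ z≡x
... | no _ | yes z≡y = inj₂ z≡y
... | no z≢x | no z≢y = ⊥-elim (changed (slide-unchanged D z≢x z≢y))

module _ {n : ℕ} (G : Graph n) where

  slide⇒TSStep : ∀ {D x y} → x ∈ D → y ∉ D → Adj G x y → TSStep G D (slide D x y)
  slide⇒TSStep {D} {x} {y} x∈D y∉D xy =
    x , y , x∈D , lookup≡false⇒∉ x-emptied , y∉D , y-filled , xy , frame
    where
    x-emptied : lookup (slide D x y) x ≡ false
    x-emptied =
      trans (lookup∘update′ (∈∉⇒≢ x∈D y∉D) (D [ x ]≔ false) true) (lookup∘update x D false)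

    y-filled : y ∈ slide D x y
    y-filled = lookup⇒[]= y (slide D x y) (lookup∘update y (D [ x ]≔ false) true)

    frame : ∀ z → z ≢ x → z ≢ y → (z ∈ D → z ∈ slide D x y) × (z ∈ slide D x y → z ∈ D)
    frame z z≢x z≢y =
      (λ z∈D → lookup⇒[]= z (slide D x y) (trans same ([]=⇒lookup z∈D))) ,
      (λ z∈D' → lookup⇒[]= z D (trans (sym same) ([]=⇒lookup z∈D')))
      where
      same : lookup (slide D x y) z ≡ lookup D z
      same = slide-unchanged D z≢x z≢y

  TSStep⇒slide : ∀ {D D'} → TSStep G D D' →
                 ∃₂ λ x y → x ∈ D × y ∉ D × Adj G x y × D' ≡ slide D x y
  TSStep⇒slide {D} {D'} (x , y , x∈D , x∉D' , y∉D , y∈D' , xy , frame) =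
    x , y , x∈D , y∉D , xy , Pointwise-≡⇒≡ (ext agree)
    where
    agree : ∀ z → lookup D' z ≡ lookup (slide D x y) z
    agree z with z ≟ y
    ... | yes refl = trans ([]=⇒lookup y∈D') (sym (lookup∘update z (D [ x ]≔ false) true))
    ... | no z≢y with z ≟ x
    ...   | yes refl = trans (∉⇒lookup≡false x∉D')
                         (sym (trans (lookup∘update′ z≢y (D [ x ]≔ false) true) (lookup∘update z D false)))
    ...   | no z≢x = trans (∈⇔⇒lookup≡ (frame z z≢x z≢y)) (sym (slide-unchanged D z≢x z≢y))

  TSSeq⇒IsD2DS : ∀ {D D' q} → TSSeq G D D' q → IsD2DS G D
  TSSeq⇒IsD2DS (done dom) = dom
  TSSeq⇒IsD2DS (step dom _ _) = dom

parityOn : ∀ {n} → (Fin n → Bool) → Subset n → Bool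
parityOn c [] = false
parityOn c (d ∷ D) = c zero ∧ d xor parityOn (c ∘ suc) D

parityOn-[]≔ : ∀ {n} (c : Fin n → Bool) (D : Subset n) i b →
               parityOn c (D [ i ]≔ b) ≡ parityOn c D xor c i ∧ (lookup D i xor b)
parityOn-[]≔ c (d ∷ D) zero b = replace (c zero) d b (parityOn (c ∘ suc) D)
  where
  replace : ∀ c d b p → c ∧ b xor p ≡ (c ∧ d xor p) xor c ∧ (d xor b)
  replace false d b p = sym (xor-identityʳ p)
  replace true false b p = xor-comm b p
  replace true true false false = refl
  replace true true false true = refl
  replace true true true false = refl
  replace true true true true = refl
parityOn-[]≔ c (d ∷ D) (suc i) b = begin
  c zero ∧ d xor parityOn (c ∘ suc) (D [ i ]≔ b)
    ≡⟨ cong (c zero ∧ d xor_) (parityOn-[]≔ (c ∘ suc) D i b) ⟩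
  c zero ∧ d xor (parityOn (c ∘ suc) D xor c (suc i) ∧ (lookup D i xor b))
    ≡⟨ sym (xor-assoc (c zero ∧ d) _ _) ⟩
  (c zero ∧ d xor parityOn (c ∘ suc) D) xor c (suc i) ∧ (lookup D i xor b) ∎

parityOn-slide : ∀ {n} (c : Fin n → Bool) (D : Subset n) {x y} → x ∈ D → y ∉ D →
                 parityOn c (slide D x y) ≡ parityOn c D xor c x xor c y
parityOn-slide c D {x} {y} x∈D y∉D = begin
  parityOn c (slide D x y)
    ≡⟨ parityOn-[]≔ c (D [ x ]≔ false) y true ⟩
  parityOn c (D [ x ]≔ false) xor c y ∧ (lookup (D [ x ]≔ false) y xor true)
    ≡⟨ cong₂ _xor_ (parityOn-[]≔ c D x false)
                   (cong (λ b → c y ∧ (b xor true)) (lookup∘update′ (∈∉⇒≢ x∈D y∉D ∘ sym) D false)) ⟩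
  (parityOn c D xor c x ∧ (lookup D x xor false)) xor c y ∧ (lookup D y xor true)
    ≡⟨ cong₂ (λ s t → (parityOn c D xor c x ∧ (s xor false)) xor c y ∧ (t xor true))
             ([]=⇒lookup x∈D) (∉⇒lookup≡false y∉D) ⟩
  (parityOn c D xor c x ∧ true) xor c y ∧ true
    ≡⟨ cong₂ (λ s t → (parityOn c D xor s) xor t) (∧-identityʳ (c x)) (∧-identityʳ (c y)) ⟩
  (parityOn c D xor c x) xor c y
    ≡⟨ xor-assoc (parityOn c D) (c x) (c y) ⟩
  parityOn c D xor c x xor c y ∎

parityOn-false : ∀ {n} (D : Subset n) → parityOn (λ _ → false) D ≡ false
parityOn-false [] = refl
parityOn-false (_ ∷ D) = parityOn-false D

Is2Colouring : ∀ {n} → Graph n → (Fin n → Bool) → Set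
Is2Colouring G c = ∀ u v → Adj G u v → c u xor c v ≡ true

module _ {n : ℕ} {G : Graph n} (c : Fin n → Bool) (colouring : Is2Colouring G c) where

  TSStep-flips-parity : ∀ {D D'} → TSStep G D D' → parityOn c D' ≡ not (parityOn c D)
  TSStep-flips-parity {D} st with TSStep⇒slide G st
  ... | x , y , x∈D , y∉D , xy , refl = begin
    parityOn c (slide D x y)        ≡⟨ parityOn-slide c D x∈D y∉D ⟩
    parityOn c D xor c x xor c y    ≡⟨ cong (parityOn c D xor_) (colouring x y xy) ⟩
    parityOn c D xor true           ≡⟨ xor-comm (parityOn c D) true ⟩
    not (parityOn c D)              ∎

  TSSeq-parity : ∀ {D D' q} → TSSeq G D D' q → parityOn c D' ≡ iterate not (parityOn c D) q
  TSSeq-parity (done _) = refl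
  TSSeq-parity {q = suc q} (step _ st rest) =
    trans (TSSeq-parity rest) (cong (λ p → iterate not p q) (TSStep-flips-parity st))

≤-sum-tabulate : ∀ {n} (h : Fin n → ℕ) z → h z ≤ sum (tabulate h)
≤-sum-tabulate h zero = m≤m+n (h zero) _
≤-sum-tabulate h (suc z) = ≤-trans (≤-sum-tabulate (h ∘ suc) z) (m≤n+m _ (h zero))

+-≤-sum-tabulate : ∀ {n} (h : Fin n → ℕ) z z' → z ≢ z' → h z + h z' ≤ sum (tabulate h)
+-≤-sum-tabulate h zero zero z≢z = ⊥-elim (z≢z refl)
+-≤-sum-tabulate h zero (suc z') _ = +-monoʳ-≤ (h zero) (≤-sum-tabulate (h ∘ suc) z')
+-≤-sum-tabulate h (suc z) zero _ =
  subst (_≤ sum (tabulate h)) (+-comm (h zero) (h (suc z))) (+-monoʳ-≤ (h zero) (≤-sum-tabulate (h ∘ suc) z))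
+-≤-sum-tabulate h (suc z) (suc z') z≢z' =
  ≤-trans (+-≤-sum-tabulate (h ∘ suc) z z' (z≢z' ∘ cong suc)) (m≤n+m _ (h zero))

sum-tabulate-0 : ∀ {n} (h : Fin n → ℕ) → (∀ z → h z ≡ 0) → sum (tabulate h) ≡ 0
sum-tabulate-0 {zero} h h≡0 = refl
sum-tabulate-0 {suc n} h h≡0 rewrite h≡0 zero = sum-tabulate-0 (h ∘ suc) (h≡0 ∘ suc)

pattern a = zero
pattern b = suc zero
pattern c = suc (suc zero)
pattern u = suc (suc (suc zero))
pattern w = suc (suc (suc (suc zero)))
pattern x e = suc (suc (suc (suc (suc e))))

module Gadget (j : ℕ) where

  N : ℕ
  N = 5 + j

  side : Fin N → Bool
  side a = true
  side c = true
  side _ = false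

  inK : Fin N → Bool
  inK a = true
  inK b = true
  inK _ = false

  G : Graph N
  G = record
    { E = λ p q → (side p xor side q) ∧ (inK p ∨ inK q)
    ; sym = λ p q → cong₂ _∧_ (xor-comm (side p) (side q)) (∨-comm (inK p) (inK q))
    ; irref = λ p → cong (_∧ (inK p ∨ inK p)) (xor-same (side p))
    }

  colouring : Is2Colouring G side
  colouring p q pq with side p xor side q
  colouring p q () | false
  ... | true = refl

  inK⇒ab : ∀ p → inK p ≡ true → p ≡ a ⊎ p ≡ b
  inK⇒ab a _ = inj₁ refl
  inK⇒ab b _ = inj₂ refl
  inK⇒ab c ()
  inK⇒ab u ()
  inK⇒ab w ()
  inK⇒ab (x _) ()

  split : IsSplit G
  split = tabulate inK , clique , independent
    where
    inK≡ : ∀ p → lookup (tabulate inK) p ≡ inK p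
    inK≡ = lookup∘tabulate inK

    clique : ∀ p q → p ∈ tabulate inK → q ∈ tabulate inK → p ≢ q → Adj G p q
    clique p q p∈K q∈K p≢q
      with inK⇒ab p (trans (sym (inK≡ p)) ([]=⇒lookup p∈K))
         | inK⇒ab q (trans (sym (inK≡ q)) ([]=⇒lookup q∈K))
    ... | inj₁ refl | inj₁ refl = ⊥-elim (p≢q refl)
    ... | inj₁ refl | inj₂ refl = refl
    ... | inj₂ refl | inj₁ refl = refl
    ... | inj₂ refl | inj₂ refl = ⊥-elim (p≢q refl)

    independent : ∀ p q → p ∉ tabulate inK → q ∉ tabulate inK → ¬ Adj G p q
    independent p q p∉K q∉K pq = case trans (sym no-edge) pq of λ ()
      where
      no-edge : E G p q ≡ false
      no-edge = trans (cong ((side p xor side q) ∧_)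
                            (cong₂ _∨_ (trans (sym (inK≡ p)) (∉⇒lookup≡false p∉K))
                                       (trans (sym (inK≡ q)) (∉⇒lookup≡false q∉K))))
                      (∧-zeroʳ (side p xor side q))

  from-a : ∀ v → Σ ℕ λ d → d ≤ 2 × Walk G a v d
  from-a a = 0 , z≤n , here
  from-a b = 1 , s≤s z≤n , there refl here
  from-a c = 2 , s≤s (s≤s z≤n) , there {w = b} refl (there refl here)
  from-a u = 1 , s≤s z≤n , there refl here
  from-a w = 1 , s≤s z≤n , there refl here
  from-a (x _) = 1 , s≤s z≤n , there refl here

  from-b : ∀ v → Σ ℕ λ d → d ≤ 2 × Walk G b v d
  from-b a = 1 , s≤s z≤n , there refl here
  from-b b = 0 , z≤n , here
  from-b c = 1 , s≤s z≤n , there refl here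
  from-b u = 2 , s≤s (s≤s z≤n) , there {w = a} refl (there refl here)
  from-b w = 2 , s≤s (s≤s z≤n) , there {w = a} refl (there refl here)
  from-b (x _) = 2 , s≤s (s≤s z≤n) , there {w = a} refl (there refl here)

  connected : Connected G
  connected = hub⇒Connected G a λ v → let (d , _ , p) = from-a v in d , p

  a-dominates : ∀ {D} → a ∈ D → IsD2DS G D
  a-dominates a∈D v = a , a∈D , from-a v

  b-dominates : ∀ {D} → b ∈ D → IsD2DS G D
  b-dominates b∈D v = b , b∈D , from-b v

  c-neighbour : ∀ p → Adj G p c → p ≡ b
  c-neighbour a ()
  c-neighbour b _ = refl
  c-neighbour c ()
  c-neighbour u ()
  c-neighbour w ()
  c-neighbour (x _) ()

  b-neighbour : ∀ p → Adj G p b → p ≡ a ⊎ p ≡ c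
  b-neighbour a _ = inj₁ refl
  b-neighbour b ()
  b-neighbour c _ = inj₂ refl
  b-neighbour u ()
  b-neighbour w ()
  b-neighbour (x _) ()

  c-dominator : ∀ {D} → IsD2DS G D → a ∈ D ⊎ b ∈ D ⊎ c ∈ D
  c-dominator dom with dom c
  ... | _ , z∈D , _ , _ , here = inj₂ (inj₂ z∈D)
  ... | z , z∈D , _ , _ , there zc here with c-neighbour z zc
  ...   | refl = inj₂ (inj₁ z∈D)
  c-dominator dom | z , z∈D , _ , _ , there {w = m} zm (there mc here) with c-neighbour m mc
  ...   | refl with b-neighbour z zm
  ...     | inj₁ refl = inj₁ z∈D
  ...     | inj₂ refl = inj₂ (inj₂ z∈D)
  c-dominator dom | _ , _ , _ , s≤s (s≤s ()) , there _ (there _ (there _ _))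

  leaf-neighbour : ∀ p {q} → side p ≡ false → inK p ≡ false → Adj G p q → q ≡ a
  leaf-neighbour p {a} _ _ _ = refl
  leaf-neighbour p {b} s _ pq rewrite s = case pq of λ ()
  leaf-neighbour p {c} s i pq rewrite s | i = case pq of λ ()
  leaf-neighbour p {u} s _ pq rewrite s = case pq of λ ()
  leaf-neighbour p {w} s _ pq rewrite s = case pq of λ ()
  leaf-neighbour p {x _} s _ pq rewrite s = case pq of λ ()

  Ds Dt D₁ D₂ D₃ : Subset N
  Ds = true ∷ false ∷ false ∷ true ∷ false ∷ ⊤
  Dt = true ∷ false ∷ false ∷ false ∷ true ∷ ⊤
  D₁ = slide Ds a b
  D₂ = slide D₁ u a
  D₃ = slide D₂ a w

  u∈Ds : u ∈ Ds
  u∈Ds = there (there (there here))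

  x∈Ds : ∀ {e} → x e ∈ Ds
  x∈Ds = there (there (there (there (there ∈⊤))))

  w∉Ds : w ∉ Ds
  w∉Ds (there (there (there (there ()))))

  w∈Dt : w ∈ Dt
  w∈Dt = there (there (there (there here)))

  u∉Dt : u ∉ Dt
  u∉Dt (there (there (there ())))

  reconfiguration : TSSeq G Ds Dt 4
  reconfiguration =
    step (a-dominates here) a↦b (step (b-dominates (there here)) u↦a (
    step (a-dominates here) a↦w (step (b-dominates (there here)) b↦a (done (a-dominates here)))))
    where
    a↦b : TSStep G Ds D₁
    a↦b = slide⇒TSStep G {D = Ds} {x = a} {y = b} here (λ { (there ()) }) refl
    u↦a : TSStep G D₁ D₂
    u↦a = slide⇒TSStep G {D = D₁} {x = u} {y = a} (there (there (there here))) (λ ()) refl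
    a↦w : TSStep G D₂ D₃
    a↦w = slide⇒TSStep G {D = D₂} {x = a} {y = w} here (λ { (there (there (there (there ())))) }) refl
    b↦a : TSStep G D₃ Dt
    b↦a = slide⇒TSStep G {D = D₃} {x = b} {y = a} (there here) (λ ()) refl

  first-move : ∀ {D'} → TSStep G Ds D' → IsD2DS G D' → D' ≡ D₁
  first-move st dom with TSStep⇒slide G st
  ... | a , b , _ , _ , _ , refl = refl
  ... | a , w , _ , _ , _ , refl with c-dominator dom
  ...   | inj₁ ()
  ...   | inj₂ (inj₁ (there ()))
  ...   | inj₂ (inj₂ (there (there ())))
  first-move st dom | a , a , _ , _ , () , _
  first-move st dom | a , c , _ , _ , () , _
  first-move st dom | a , u , _ , u∉Ds , _ , _ = ⊥-elim (u∉Ds u∈Ds)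
  first-move st dom | a , x _ , _ , x∉Ds , _ , _ = ⊥-elim (x∉Ds x∈Ds)
  first-move st dom | b , _ , there () , _
  first-move st dom | c , _ , there (there ()) , _
  first-move st dom | w , _ , w∈Ds , _ = ⊥-elim (w∉Ds w∈Ds)
  first-move st dom | u , y , _ , y∉Ds , uy , _ =
    ⊥-elim (y∉Ds (subst (_∈ Ds) (sym (leaf-neighbour u refl refl uy)) here))
  first-move st dom | x e , y , _ , y∉Ds , xy , _ =
    ⊥-elim (y∉Ds (subst (_∈ Ds) (sym (leaf-neighbour (x e) refl refl xy)) here))

  D₁↛Dt : ¬ TSStep G D₁ Dt
  D₁↛Dt st with TSStep⇒slide G st
  ... | p , q , _ , _ , _ , Dt≡ =
    three-into-two (changed a (λ ())) (changed b (λ ())) (changed u (λ ()))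
    where
    changed : ∀ z → lookup Dt z ≢ lookup D₁ z → z ≡ p ⊎ z ≡ q
    changed z ne = slide-changed D₁ z (subst (λ D → lookup D z ≢ lookup D₁ z) Dt≡ ne)

    three-into-two : a ≡ p ⊎ a ≡ q → b ≡ p ⊎ b ≡ q → u ≡ p ⊎ u ≡ q → ⊥
    three-into-two (inj₁ refl) (inj₁ ()) _
    three-into-two (inj₁ refl) (inj₂ refl) (inj₁ ())
    three-into-two (inj₁ refl) (inj₂ refl) (inj₂ ())
    three-into-two (inj₂ refl) (inj₂ ()) _
    three-into-two (inj₂ refl) (inj₁ refl) (inj₁ ())
    three-into-two (inj₂ refl) (inj₁ refl) (inj₂ ())

  parityOn-side : ∀ D → parityOn side D ≡ lookup D a xor lookup D c
  parityOn-side (da ∷ _ ∷ dc ∷ _ ∷ _ ∷ D) rewrite parityOn-false D = cong (da xor_) (xor-identityʳ dc)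

  odd-length : ∀ {q} → TSSeq G D₁ Dt q → true ≡ iterate not false q
  odd-length {q} seq = begin
    true                               ≡⟨ sym (parityOn-side Dt) ⟩
    parityOn side Dt                   ≡⟨ TSSeq-parity side colouring seq ⟩
    iterate not (parityOn side D₁) q   ≡⟨ cong (λ p → iterate not p q) (parityOn-side D₁) ⟩
    iterate not false q                ∎

  from-D₁ : ∀ q → TSSeq G D₁ Dt q → 3 ≤ q
  from-D₁ q seq with odd-length seq
  from-D₁ zero _ | ()
  from-D₁ (suc zero) (step _ st (done _)) | _ = ⊥-elim (D₁↛Dt st)
  from-D₁ (suc (suc zero)) _ | ()
  from-D₁ (suc (suc (suc _))) _ | _ = s≤s (s≤s (s≤s z≤n))

  opt-lower : ∀ m → TSSeq G Ds Dt m → 4 ≤ m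
  opt-lower (suc q) (step _ st rest) with first-move st (TSSeq⇒IsD2DS G rest)
  ... | refl = s≤s (from-D₁ q rest)

  σ : Fin N → Fin N
  σ u = w
  σ w = u
  σ p = p

  σ-involutive : ∀ p → σ (σ p) ≡ p
  σ-involutive a = refl
  σ-involutive b = refl
  σ-involutive c = refl
  σ-involutive u = refl
  σ-involutive w = refl
  σ-involutive (x _) = refl

  Dt∘σ : ∀ p → lookup Dt (σ p) ≡ lookup Ds p
  Dt∘σ a = refl
  Dt∘σ b = refl
  Dt∘σ c = refl
  Dt∘σ u = refl
  Dt∘σ w = refl
  Dt∘σ (x _) = refl

  σ-bijection : IsBij Ds Dt σ
  σ-bijection =
    (λ p p∈Ds → lookup⇒[]= (σ p) Dt (trans (Dt∘σ p) ([]=⇒lookup p∈Ds))) ,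
    (λ p p' _ _ σp≡σp' → trans (sym (σ-involutive p)) (trans (cong σ σp≡σp') (σ-involutive p'))) ,
    (λ q q∈Dt → σ q ,
       lookup⇒[]= (σ q) Ds
         (trans (sym (Dt∘σ (σ q))) (trans (cong (lookup Dt) (σ-involutive q)) ([]=⇒lookup q∈Dt))) ,
       σ-involutive q)

  u-w-far : ∀ m → Walk G u w m → 2 ≤ m
  u-w-far _ (there () here)
  u-w-far _ (there _ (there _ _)) = s≤s (s≤s z≤n)

  σ-distance : Fin N → ℕ
  σ-distance u = 2
  σ-distance _ = 0

  σ-cost : BijCost G Ds σ 2
  σ-cost = σ-distance , distance ,
           cong (2 +_) (sym (sum-tabulate-0 (λ e → if lookup (⊤ {j}) e then 0 else 0)
                                            (λ e → if-eta (lookup ⊤ e))))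
    where
    distance : ∀ p → p ∈ Ds → IsDist G p (σ p) (σ-distance p)
    distance a _ = here , λ _ _ → z≤n
    distance u _ = there {w = a} refl (there refl here) , u-w-far
    distance (x _) _ = here , λ _ _ → z≤n
    distance b (there ())
    distance c (there (there ()))
    distance w w∈Ds = ⊥-elim (w∉Ds w∈Ds)

  -- Some z ∈ Ds is sent to w: either z = u, at distance 2, or u and z both move.
  bijection-cost≥2 : ∀ f cost → IsBij Ds Dt f → BijCost G Ds f cost → 2 ≤ cost
  bijection-cost≥2 f cost (f-into , _ , f-onto) (d , d-dist , cost≡) with f-onto w w∈Dt
  ... | z , z∈Ds , fz≡w = subst (2 ≤_) (sym cost≡) (cases (z ≟ u))
    where
    h : Fin N → ℕ
    h p = if lookup Ds p then d p else 0

    h≡d : ∀ {p} → p ∈ Ds → h p ≡ d p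
    h≡d p∈Ds rewrite []=⇒lookup p∈Ds = refl

    moves : ∀ {p} → p ∈ Ds → p ≢ f p → 1 ≤ h p
    moves p∈Ds p≢fp = subst (1 ≤_) (sym (h≡d p∈Ds)) (walk-length-pos G (proj₁ (d-dist _ p∈Ds)) p≢fp)

    cases : Dec (z ≡ u) → 2 ≤ sum (tabulate h)
    cases (yes refl) =
      ≤-trans (u-w-far _ (subst (λ q → Walk G u q (d u)) fz≡w (proj₁ (d-dist u u∈Ds))))
              (subst (_≤ sum (tabulate h)) (h≡d u∈Ds) (≤-sum-tabulate h u))
    cases (no z≢u) =
      ≤-trans (+-mono-≤ (moves u∈Ds λ u≡fu → u∉Dt (subst (_∈ Dt) (sym u≡fu) (f-into u u∈Ds)))
                        (moves z∈Ds λ z≡fz → w∉Ds (subst (_∈ Ds) (trans z≡fz fz≡w) z∈Ds)))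
              (+-≤-sum-tabulate h u z (z≢u ∘ sym))

  M⋆ : IsMstar G Ds Dt 2
  M⋆ = (σ , σ-bijection , σ-cost) , bijection-cost≥2

  ∣Ds∣ : ∣ Ds ∣ ≡ 2 + j
  ∣Ds∣ = cong (2 +_) (∣⊤∣≡n j)

  ∣Dt∣ : ∣ Dt ∣ ≡ 2 + j
  ∣Dt∣ = cong (2 +_) (∣⊤∣≡n j)

lemma13 : ∀ (k : ℕ) → 2 ≤ k →
    Σ ℕ λ n → Σ (Graph n) λ G → IsSplit G × Connected G ×
      Σ (Subset n) λ Ds → Σ (Subset n) λ Dt →
        IsD2DS G Ds × IsD2DS G Dt × ∣ Ds ∣ ≡ k × ∣ Dt ∣ ≡ k ×
        Σ ℕ λ m → IsMstar G Ds Dt m × IsOptTS G Ds Dt (m + 2)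
lemma13 (suc zero) (s≤s ())
lemma13 (suc (suc j)) _ =
  N , G , split , connected , Ds , Dt , a-dominates here , a-dominates here , ∣Ds∣ , ∣Dt∣ ,
  2 , M⋆ , reconfiguration , opt-lower
  where open Gadget j
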